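{- Let $\alpha\in\mathbb N=\{1,2,\dots\}$ and $n\ge0$. The matrix $\left(1/F_{\alpha+i+j}\right)_{i,j=0}^n$ is invertible, and the $(i,j)$-th entry ($0\le i,j\le n$) of its inverse is $$(-1)^{n(\alpha+i+j)-\binom{i}{2}-\binom{j}{2}}\,F_{\alpha+i+j}\binom{\alpha+n+i}{n-j}_{\mathbb F}\binom{\alpha+n+j}{n-i}_{\mathbb F}\binom{\alpha+i+j-1}{i}_{\mathbb F}\binom{\alpha+i+j-1}{j}_{\mathbb F}.$$
   Context: $F_n$ denotes the Fibonacci numbers: $F_0=0$, $F_1=1$, $F_{n+1}=F_n+F_{n-1}$. The Fibonomial coefficients are $\binom{m}{k}_{\mathbb F}=\prod_{l=1}^k\frac{F_{m-l+1}}{F_l}$ for $0\le k\le m$ (empty product $=1$). -}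

module Defs where

open import Data.Nat as ℕ using (ℕ; zero; suc; _∸_; _%_)
open import Data.Integer as ℤ using (ℤ; +_; ∣_∣)
open import Data.Rational using (ℚ; 0ℚ; 1ℚ; _/_; _*_; _+_; -_)
open import Data.Fin using (Fin; zero; suc; _≟_)
open import Relation.Nullary using (yes; no)

fib : ℕ → ℕ
fib zero = zero
fib (suc zero) = 1
fib (suc (suc n)) = fib (suc n) ℕ.+ fib n

-- 1 / F m as a rational (junk value 0 when F m = 0, i.e. m = 0; never used)
invFib : ℕ → ℚ
invFib m with fib m
... | zero = 0ℚ
... | suc k = (+ 1) / suc k

fibℚ : ℕ → ℚ
fibℚ m = (+ fib m) / 1

fibonomial : ℕ → ℕ → ℚ
fibonomial m zero = 1ℚ
fibonomial m (suc k) = fibonomial m k * (fibℚ (m ∸ k) * invFib (suc k))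

negOnePow : ℤ → ℚ
negOnePow z with ∣ z ∣ % 2
... | zero = 1ℚ
... | suc _ = - 1ℚ

Matrix : ℕ → Set
Matrix m = Fin m → Fin m → ℚ

sumFin : ∀ {m} → (Fin m → ℚ) → ℚ
sumFin {zero} f = 0ℚ
sumFin {suc m} f = f zero + sumFin (λ k → f (suc k))

_·_ : ∀ {m} → Matrix m → Matrix m → Matrix m
(A · B) i j = sumFin (λ k → A i k * B k j)

identity : ∀ {m} → Matrix m
identity i j with i ≟ j
... | yes _ = 1ℚ
... | no _ = 0ℚ

-- With U i = (F (i+1), F i) and V m = (- F m, F (m+1)) in ℚ², the addition formula gives
-- det (U i) (V (α - 1 + k)) = F (α + i + k), so the matrix is (1 / det (U i) (V' k)) with
-- V' k = V (α - 1 + k): a Cauchy matrix on the projective line. For fixed j the rational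
-- function X ↦ ∏_{m ≠ j} det X (U m) / ∏_k det X (V' k) has the partial fraction expansion
-- Σ_k r_k / det X (V' k) (by induction on n, one Plücker relation per step). At X = U i it
-- vanishes unless i = j, so r_k divided by its value at U j is the (k, j) entry of the inverse.
-- d'Ocagne's identity makes det (P x) (P (x + d)) = ± F d for both families, hence all the
-- products of determinants are signed products of Fibonacci numbers, which regroup into the
-- four fibonomials. Both matrices are symmetric, so the right inverse is also a left inverse.
module Submission where

open import Defs

module Filbert where

  open import Level using (0ℓ)
  open import Algebra.Bundles using (CommutativeRing)
  import Algebra.Properties.CommutativeMonoid.Sum as CommutativeMonoidSum
  import Algebra.Properties.Semiring.Sum as SemiringSum
  open import Data.Empty using (⊥-elim)
  open import Data.Fin as Fin using (Fin; zero; suc; toℕ; punchIn; punchOut)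
  import Data.Fin.Properties as Fin
  open import Data.Integer as ℤ using (+_; -[1+_]; ∣_∣)
  import Data.Integer.Properties as ℤ
  import Data.Integer.Tactic.RingSolver as ℤ-Solver
  open import Data.Nat as ℕ using (ℕ; zero; suc; _∸_; _<_; _≤_)
  import Data.Nat.Coprimality as Coprimality
  open import Data.Nat.Combinatorics using (_C_; nC1≡n; nCk+nC[k+1]≡[n+1]C[k+1])
  import Data.Nat.DivMod as ℕ
  import Data.Nat.Properties as ℕ
  import Data.Nat.Tactic.RingSolver as ℕ-Solver
  open import Data.Product using (_×_; _,_)
  open import Data.Sum using (inj₁; inj₂)
  open import Data.Rational as ℚ using (ℚ; mkℚ; 0ℚ; 1ℚ; _+_; _*_; -_; _-_; 1/_)
  import Data.Rational.Properties as ℚ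
  import Data.Rational.Unnormalised as ℚᵘ using (*≡*)
  import Data.Rational.Unnormalised.Properties as ℚᵘ
  open import Data.Vec.Functional using (removeAt; tail)
  open import Function using (_∘_)
  open import Relation.Binary.PropositionalEquality
  open import Relation.Binary using (tri<; tri≈; tri>)
  open import Relation.Nullary using (yes; no)
  open import Relation.Nullary.Decidable using (dec⇒maybe; toSum)
  open import Tactic.RingSolver using (solve-∀)
  open import Tactic.RingSolver.Core.AlmostCommutativeRing
    using (AlmostCommutativeRing; fromCommutativeRing)
  open import Algebra.Apartness.Properties.HeytingCommutativeRing ℚ.heytingCommutativeRing
    using () renaming (x#0y#0→xy#0 to *-≢0)
  open import Algebra.Properties.CommutativeSemigroup ℕ.+-commutativeSemigroup
    using () renaming (xy∙z≈xz∙y to +-right-comm)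
  open ≡-Reasoning

  ℚ-ring : AlmostCommutativeRing 0ℓ 0ℓ
  ℚ-ring = fromCommutativeRing ℚ.+-*-commutativeRing (λ x → dec⇒maybe (0ℚ ℚ.≟ x))

  -- A total inverse: 0 ⁻¹ = 0, so that _⁻¹ distributes over _*_ unconditionally.
  infixl 9 _⁻¹
  _⁻¹ : ℚ → ℚ
  p ⁻¹ with p ℚ.≟ 0ℚ
  ... | yes _   = 0ℚ
  ... | no  p≢0 = 1/_ p {{ℚ.≢-nonZero p≢0}}

  ⁻¹-inverseˡ : ∀ {p} → p ≢ 0ℚ → p ⁻¹ * p ≡ 1ℚ
  ⁻¹-inverseˡ {p} p≢0 with p ℚ.≟ 0ℚ
  ... | yes p≡0  = ⊥-elim (p≢0 p≡0)
  ... | no  p≢0′ = ℚ.*-inverseˡ p {{ℚ.≢-nonZero p≢0′}}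

  ⁻¹-inverseʳ : ∀ {p} → p ≢ 0ℚ → p * p ⁻¹ ≡ 1ℚ
  ⁻¹-inverseʳ {p} p≢0 = trans (ℚ.*-comm p (p ⁻¹)) (⁻¹-inverseˡ p≢0)

  *-⁻¹-cancelʳ : ∀ {p} → p ≢ 0ℚ → ∀ x → x * p * p ⁻¹ ≡ x
  *-⁻¹-cancelʳ {p} p≢0 x = begin
    x * p * p ⁻¹   ≡⟨ ℚ.*-assoc x p (p ⁻¹) ⟩
    x * (p * p ⁻¹) ≡⟨ cong (x *_) (⁻¹-inverseʳ p≢0) ⟩
    x * 1ℚ         ≡⟨ ℚ.*-identityʳ x ⟩
    x              ∎

  ⁻¹-unique : ∀ {p x} → x * p ≡ 1ℚ → x ≡ p ⁻¹
  ⁻¹-unique {p} {x} xp≡1 = begin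
    x            ≡⟨ *-⁻¹-cancelʳ p≢0 x ⟨
    x * p * p ⁻¹ ≡⟨ cong (_* p ⁻¹) xp≡1 ⟩
    1ℚ * p ⁻¹    ≡⟨ ℚ.*-identityˡ (p ⁻¹) ⟩
    p ⁻¹         ∎
    where
    p≢0 : p ≢ 0ℚ
    p≢0 p≡0 = ℚ.1≢0 (trans (sym xp≡1) (trans (cong (x *_) p≡0) (ℚ.*-zeroʳ x)))

  ⁻¹-≢0 : ∀ {p} → p ≢ 0ℚ → p ⁻¹ ≢ 0ℚ
  ⁻¹-≢0 {p} p≢0 p⁻¹≡0 =
    ℚ.1≢0 (trans (sym (⁻¹-inverseˡ p≢0)) (trans (cong (_* p) p⁻¹≡0) (ℚ.*-zeroˡ p)))

  ⁻¹-distrib-* : ∀ p q → (p * q) ⁻¹ ≡ p ⁻¹ * q ⁻¹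
  ⁻¹-distrib-* p q with toSum (p ℚ.≟ 0ℚ) | toSum (q ℚ.≟ 0ℚ)
  ... | inj₁ refl | _         = trans (cong _⁻¹ (ℚ.*-zeroˡ q)) (sym (ℚ.*-zeroˡ (q ⁻¹)))
  ... | inj₂ _    | inj₁ refl = trans (cong _⁻¹ (ℚ.*-zeroʳ p)) (sym (ℚ.*-zeroʳ (p ⁻¹)))
  ... | inj₂ p≢0  | inj₂ q≢0  = sym (⁻¹-unique (begin
    p ⁻¹ * q ⁻¹ * (p * q)   ≡⟨ interchange (p ⁻¹) (q ⁻¹) p q ⟩
    p ⁻¹ * p * (q ⁻¹ * q)   ≡⟨ cong₂ _*_ (⁻¹-inverseˡ p≢0) (⁻¹-inverseˡ q≢0) ⟩
    1ℚ                      ∎))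
    where
    interchange : ∀ a b c d → a * b * (c * d) ≡ a * c * (b * d)
    interchange = solve-∀ ℚ-ring

  ⁻¹-involutive : ∀ p → p ⁻¹ ⁻¹ ≡ p
  ⁻¹-involutive p with toSum (p ℚ.≟ 0ℚ)
  ... | inj₁ refl = refl
  ... | inj₂ p≢0  = sym (⁻¹-unique (⁻¹-inverseʳ p≢0))

  ratio-⁻¹ : ∀ x y → (x * y ⁻¹) ⁻¹ ≡ x ⁻¹ * y
  ratio-⁻¹ x y = trans (⁻¹-distrib-* x (y ⁻¹)) (cong (x ⁻¹ *_) (⁻¹-involutive y))

  ⁻¹-neg : ∀ p → (- p) ⁻¹ ≡ - p ⁻¹
  ⁻¹-neg p with toSum (p ℚ.≟ 0ℚ)
  ... | inj₁ refl = refl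
  ... | inj₂ p≢0  = sym (⁻¹-unique (trans (neg*neg (p ⁻¹) p) (⁻¹-inverseˡ p≢0)))
    where
    neg*neg : ∀ a b → (- a) * (- b) ≡ a * b
    neg*neg = solve-∀ ℚ-ring

  sign : ℕ → ℚ
  sign zero    = 1ℚ
  sign (suc n) = - sign n

  sign-+ : ∀ m n → sign (m ℕ.+ n) ≡ sign m * sign n
  sign-+ zero    n = sym (ℚ.*-identityˡ (sign n))
  sign-+ (suc m) n = trans (cong -_ (sign-+ m n)) (ℚ.neg-distribˡ-* (sign m) (sign n))

  sign*sign≡1 : ∀ n → sign n * sign n ≡ 1ℚ
  sign*sign≡1 zero    = refl
  sign*sign≡1 (suc n) = trans (neg*neg (sign n)) (sign*sign≡1 n)
    where
    neg*neg : ∀ a → (- a) * (- a) ≡ a * a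
    neg*neg = solve-∀ ℚ-ring

  sign-≢0 : ∀ n → sign n ≢ 0ℚ
  sign-≢0 n sign≡0 =
    ℚ.1≢0 (trans (sym (sign*sign≡1 n)) (trans (cong (_* sign n) sign≡0) (ℚ.*-zeroˡ (sign n))))

  sign⁻¹ : ∀ n → sign n ⁻¹ ≡ sign n
  sign⁻¹ n = sym (⁻¹-unique (sign*sign≡1 n))

  sign-*-⁻¹ : ∀ e x → (sign e * x) ⁻¹ ≡ sign e * x ⁻¹
  sign-*-⁻¹ e x = trans (⁻¹-distrib-* (sign e) x) (cong (_* x ⁻¹) (sign⁻¹ e))

  sign-square : ∀ n → sign (n ℕ.* n) ≡ sign n
  sign-square zero    = refl
  sign-square (suc n) = begin
    sign (suc n ℕ.* suc n)                   ≡⟨ cong sign (square-suc n) ⟩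
    - sign (n ℕ.* n ℕ.+ (n ℕ.+ n))           ≡⟨ cong -_ (sign-+ (n ℕ.* n) (n ℕ.+ n)) ⟩
    - (sign (n ℕ.* n) * sign (n ℕ.+ n))      ≡⟨ cong₂ (λ x y → - (x * y)) (sign-square n) (sign-+ n n) ⟩
    - (sign n * (sign n * sign n))           ≡⟨ cong (λ x → - (sign n * x)) (sign*sign≡1 n) ⟩
    - (sign n * 1ℚ)                          ≡⟨ cong -_ (ℚ.*-identityʳ (sign n)) ⟩
    sign (suc n)                             ∎
    where
    square-suc : ∀ n → suc n ℕ.* suc n ≡ suc (n ℕ.* n ℕ.+ (n ℕ.+ n))
    square-suc = ℕ-Solver.solve-∀

  sign-cancelʳ : ∀ x y t → sign (x ℕ.+ t) ≡ sign (y ℕ.+ t) → sign x ≡ sign y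
  sign-cancelʳ x y t eq = begin
    sign x                          ≡⟨ ℚ.*-identityʳ (sign x) ⟨
    sign x * 1ℚ                     ≡⟨ cong (sign x *_) (sign*sign≡1 t) ⟨
    sign x * (sign t * sign t)      ≡⟨ ℚ.*-assoc (sign x) (sign t) (sign t) ⟨
    sign x * sign t * sign t        ≡⟨ cong (_* sign t) (trans (sym (sign-+ x t)) (trans eq (sign-+ y t))) ⟩
    sign y * sign t * sign t        ≡⟨ ℚ.*-assoc (sign y) (sign t) (sign t) ⟩
    sign y * (sign t * sign t)      ≡⟨ cong (sign y *_) (sign*sign≡1 t) ⟩
    sign y * 1ℚ                     ≡⟨ ℚ.*-identityʳ (sign y) ⟩
    sign y                          ∎

  sign-+-squares : ∀ y k j → sign (y ℕ.+ (k ℕ.* k ℕ.+ j ℕ.* j)) ≡ sign (y ℕ.+ (k ℕ.+ j))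
  sign-+-squares y k j = begin
    sign (y ℕ.+ (k ℕ.* k ℕ.+ j ℕ.* j))      ≡⟨ sign-+ y (k ℕ.* k ℕ.+ j ℕ.* j) ⟩
    sign y * sign (k ℕ.* k ℕ.+ j ℕ.* j)      ≡⟨ cong (sign y *_) (sign-+ (k ℕ.* k) (j ℕ.* j)) ⟩
    sign y * (sign (k ℕ.* k) * sign (j ℕ.* j)) ≡⟨ cong₂ (λ s t → sign y * (s * t)) (sign-square k) (sign-square j) ⟩
    sign y * (sign k * sign j)               ≡⟨ cong (sign y *_) (sign-+ k j) ⟨
    sign y * sign (k ℕ.+ j)                  ≡⟨ sign-+ y (k ℕ.+ j) ⟨
    sign (y ℕ.+ (k ℕ.+ j))                   ∎

  sign-even : ∀ q → sign (q ℕ.* 2) ≡ 1ℚ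
  sign-even q = trans (cong sign (*2≡+ q)) (trans (sign-+ q q) (sign*sign≡1 q))
    where
    *2≡+ : ∀ q → q ℕ.* 2 ≡ q ℕ.+ q
    *2≡+ = ℕ-Solver.solve-∀

  sign-%2 : ∀ m → sign m ≡ sign (m ℕ.% 2)
  sign-%2 m = begin
    sign m                                ≡⟨ cong sign (ℕ.m≡m%n+[m/n]*n m 2) ⟩
    sign (m ℕ.% 2 ℕ.+ m ℕ./ 2 ℕ.* 2)      ≡⟨ sign-+ (m ℕ.% 2) (m ℕ./ 2 ℕ.* 2) ⟩
    sign (m ℕ.% 2) * sign (m ℕ./ 2 ℕ.* 2) ≡⟨ cong (sign (m ℕ.% 2) *_) (sign-even (m ℕ./ 2)) ⟩
    sign (m ℕ.% 2) * 1ℚ                   ≡⟨ ℚ.*-identityʳ (sign (m ℕ.% 2)) ⟩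
    sign (m ℕ.% 2)                        ∎

  negOnePow≡sign : ∀ z → negOnePow z ≡ sign ∣ z ∣
  negOnePow≡sign z with ∣ z ∣ ℕ.% 2 in eq
  ... | zero        = sym (trans (sign-%2 ∣ z ∣) (cong sign eq))
  ... | suc zero    = sym (trans (sign-%2 ∣ z ∣) (cong sign eq))
  ... | suc (suc _) = ⊥-elim (ℕ.<⇒≱ (ℕ.m%n<n ∣ z ∣ 2) (subst (2 ℕ.≤_) (sym eq) (ℕ.s≤s (ℕ.s≤s ℕ.z≤n))))

  sign∣z-1∣ : ∀ z → sign ∣ z ℤ.- + 1 ∣ ≡ - sign ∣ z ∣
  sign∣z-1∣ (+ zero)  = refl
  sign∣z-1∣ (+ suc m) = sym (neg-involutive (sign m))
    where
    neg-involutive : ∀ x → - - x ≡ x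
    neg-involutive = solve-∀ ℚ-ring
  sign∣z-1∣ -[1+ m ]  = cong (λ k → sign (suc (suc k))) (ℕ.+-identityʳ m)

  sign∣z-b∣ : ∀ z b → sign ∣ z ℤ.- + b ∣ ≡ sign ∣ z ∣ * sign b
  sign∣z-b∣ z zero    = trans (cong (sign ∘ ∣_∣) (ℤ.+-identityʳ z)) (sym (ℚ.*-identityʳ _))
  sign∣z-b∣ z (suc b) = begin
    sign ∣ z ℤ.- + suc b ∣              ≡⟨ cong (sign ∘ ∣_∣) (-suc z (+ b)) ⟩
    sign ∣ (z ℤ.- + b) ℤ.- + 1 ∣        ≡⟨ sign∣z-1∣ (z ℤ.- + b) ⟩
    - sign ∣ z ℤ.- + b ∣                ≡⟨ cong -_ (sign∣z-b∣ z b) ⟩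
    - (sign ∣ z ∣ * sign b)             ≡⟨ ℚ.neg-distribʳ-* (sign ∣ z ∣) (sign b) ⟩
    sign ∣ z ∣ * sign (suc b)           ∎
    where
    -suc : ∀ z c → z ℤ.- (+ 1 ℤ.+ c) ≡ (z ℤ.- c) ℤ.- + 1
    -suc = ℤ-Solver.solve-∀

  negOnePow[x-b-c]≡sign[x+b+c] : ∀ x b c → negOnePow ((+ x ℤ.- + b) ℤ.- + c) ≡ sign (x ℕ.+ b ℕ.+ c)
  negOnePow[x-b-c]≡sign[x+b+c] x b c = begin
    negOnePow ((+ x ℤ.- + b) ℤ.- + c) ≡⟨ negOnePow≡sign ((+ x ℤ.- + b) ℤ.- + c) ⟩
    sign ∣ (+ x ℤ.- + b) ℤ.- + c ∣    ≡⟨ sign∣z-b∣ (+ x ℤ.- + b) c ⟩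
    sign ∣ + x ℤ.- + b ∣ * sign c     ≡⟨ cong (_* sign c) (sign∣z-b∣ (+ x) b) ⟩
    sign x * sign b * sign c          ≡⟨ cong (_* sign c) (sign-+ x b) ⟨
    sign (x ℕ.+ b) * sign c           ≡⟨ sign-+ (x ℕ.+ b) c ⟨
    sign (x ℕ.+ b ℕ.+ c)              ∎

  open CommutativeMonoidSum ℚ.+-0-commutativeMonoid using (sum; sum-cong-≗; ∑-distrib-+)
  open SemiringSum (CommutativeRing.semiring ℚ.+-*-commutativeRing) using (*-distribˡ-sum)
  open CommutativeMonoidSum ℚ.*-1-commutativeMonoid using ()
    renaming (sum to ∏; sum-cong-≗ to ∏-cong; sum-remove to ∏-remove; ∑-distrib-+ to ∏-distrib-*)

  sumFin≡sum : ∀ {m} (f : Fin m → ℚ) → sumFin f ≡ sum f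
  sumFin≡sum {zero}  f = refl
  sumFin≡sum {suc m} f = cong (_+_ (f zero)) (sumFin≡sum (tail f))

  ∏-≢0 : ∀ {n} (f : Fin n → ℚ) → (∀ i → f i ≢ 0ℚ) → ∏ f ≢ 0ℚ
  ∏-≢0 {zero}  f _   = ℚ.1≢0
  ∏-≢0 {suc n} f f≢0 = *-≢0 (f≢0 zero) (∏-≢0 (tail f) (f≢0 ∘ suc))

  ∏-zero : ∀ {n} (f : Fin n → ℚ) i → f i ≡ 0ℚ → ∏ f ≡ 0ℚ
  ∏-zero f zero    fi≡0 = trans (cong (_* ∏ (tail f)) fi≡0) (ℚ.*-zeroˡ (∏ (tail f)))
  ∏-zero f (suc i) fi≡0 = trans (cong (f zero *_) (∏-zero (tail f) i fi≡0)) (ℚ.*-zeroʳ (f zero))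

  ∏-neg : ∀ {n} (f : Fin n → ℚ) → ∏ (λ i → - f i) ≡ sign n * ∏ f
  ∏-neg {zero}  f = sym (ℚ.*-identityˡ 1ℚ)
  ∏-neg {suc n} f = trans (cong (- f zero *_) (∏-neg (tail f))) (swap (f zero) (sign n) (∏ (tail f)))
    where
    swap : ∀ a b c → (- a) * (b * c) ≡ (- b) * (a * c)
    swap = solve-∀ ℚ-ring

  ∏-⁻¹ : ∀ {n} (f : Fin n → ℚ) → ∏ f ⁻¹ ≡ ∏ (λ i → f i ⁻¹)
  ∏-⁻¹ {zero}  f = refl
  ∏-⁻¹ {suc n} f = trans (⁻¹-distrib-* (f zero) _) (cong (f zero ⁻¹ *_) (∏-⁻¹ (tail f)))

  ∏< : ℕ → (ℕ → ℚ) → ℚ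
  ∏< r f = ∏ {r} (f ∘ toℕ)

  ∏<-cong : ∀ r {f g} → (∀ l → l < r → f l ≡ g l) → ∏< r f ≡ ∏< r g
  ∏<-cong r f≡g = ∏-cong (λ i → f≡g (toℕ i) (Fin.toℕ<n i))

  ∏<-suc : ∀ r f → ∏< (suc r) f ≡ ∏< r f * f r
  ∏<-suc zero    f = trans (ℚ.*-identityʳ (f 0)) (sym (ℚ.*-identityˡ (f 0)))
  ∏<-suc (suc r) f =
    trans (cong (f 0 *_) (∏<-suc r (f ∘ suc))) (sym (ℚ.*-assoc (f 0) (∏< r (f ∘ suc)) (f (suc r))))

  ∏<-reverse : ∀ r f → ∏< r (λ l → f (r ∸ suc l)) ≡ ∏< r f
  ∏<-reverse zero    f = refl
  ∏<-reverse (suc r) f = begin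
    f r * ∏< r (λ l → f (r ∸ suc l)) ≡⟨ cong (f r *_) (∏<-reverse r f) ⟩
    f r * ∏< r f                     ≡⟨ ℚ.*-comm (f r) (∏< r f) ⟩
    ∏< r f * f r                     ≡⟨ ∏<-suc r f ⟨
    ∏< (suc r) f                     ∎

  ∏<-sign : ∀ r e → ∏< r (λ _ → sign e) ≡ sign (r ℕ.* e)
  ∏<-sign zero    e = refl
  ∏<-sign (suc r) e = trans (cong (sign e *_) (∏<-sign r e)) (sym (sign-+ e (r ℕ.* e)))

  ∏<-sign-+ : ∀ k c → ∏< k (λ l → sign (c ℕ.+ l)) ≡ sign (k ℕ.* c ℕ.+ k C 2)
  ∏<-sign-+ zero    c = refl
  ∏<-sign-+ (suc k) c = begin
    sign (c ℕ.+ 0) * ∏< k (λ l → sign (c ℕ.+ suc l))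
      ≡⟨ cong₂ _*_ (cong sign (ℕ.+-identityʳ c)) (∏<-cong k (λ l _ → cong sign (ℕ.+-suc c l))) ⟩
    sign c * ∏< k (λ l → sign (suc c ℕ.+ l))  ≡⟨ cong (sign c *_) (∏<-sign-+ k (suc c)) ⟩
    sign c * sign (k ℕ.* suc c ℕ.+ k C 2)     ≡⟨ sign-+ c _ ⟨
    sign (c ℕ.+ (k ℕ.* suc c ℕ.+ k C 2))      ≡⟨ cong sign (gauss c k (k C 2)) ⟩
    sign (suc k ℕ.* c ℕ.+ (k ℕ.+ k C 2))      ≡⟨ cong (λ e → sign (suc k ℕ.* c ℕ.+ (e ℕ.+ k C 2))) (nC1≡n k) ⟨
    sign (suc k ℕ.* c ℕ.+ (k C 1 ℕ.+ k C 2))  ≡⟨ cong (λ e → sign (suc k ℕ.* c ℕ.+ e)) (nCk+nC[k+1]≡[n+1]C[k+1] k 1) ⟩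
    sign (suc k ℕ.* c ℕ.+ suc k C 2)          ∎
    where
    gauss : ∀ c k x → c ℕ.+ (k ℕ.* suc c ℕ.+ x) ≡ suc k ℕ.* c ℕ.+ (k ℕ.+ x)
    gauss = ℕ-Solver.solve-∀

  ∏-removeAt : ∀ n (j : Fin (suc n)) f →
    ∏ (λ m → f (toℕ (punchIn j m))) ≡ ∏< (toℕ j) f * ∏< (n ∸ toℕ j) (λ l → f (suc (toℕ j) ℕ.+ l))
  ∏-removeAt n       zero    f = sym (ℚ.*-identityˡ _)
  ∏-removeAt (suc n) (suc j) f =
    trans (cong (f 0 *_) (∏-removeAt n j (f ∘ suc))) (sym (ℚ.*-assoc (f 0) (∏< (toℕ j) (f ∘ suc)) _))

  -- Partial fractions for products of 2 × 2 determinants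

  Point : Set
  Point = ℚ × ℚ

  det : Point → Point → ℚ
  det (x₁ , x₂) (y₁ , y₂) = x₁ * y₂ - x₂ * y₁

  det-antisym : ∀ p q → det q p ≡ - det p q
  det-antisym (p₁ , p₂) (q₁ , q₂) = antisym p₁ p₂ q₁ q₂
    where
    antisym : ∀ p₁ p₂ q₁ q₂ → q₁ * p₂ - q₂ * p₁ ≡ - (p₁ * q₂ - p₂ * q₁)
    antisym = solve-∀ ℚ-ring

  det-self : ∀ p → det p p ≡ 0ℚ
  det-self (p₁ , p₂) = self p₁ p₂
    where
    self : ∀ p₁ p₂ → p₁ * p₂ - p₂ * p₁ ≡ 0ℚ
    self = solve-∀ ℚ-ring

  plücker : ∀ x a b c → det x a * det b c ≡ det b a * det x c - det c a * det x b
  plücker (x₁ , x₂) (a₁ , a₂) (b₁ , b₂) (c₁ , c₂) = identity′ x₁ x₂ a₁ a₂ b₁ b₂ c₁ c₂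
    where
    identity′ : ∀ x₁ x₂ a₁ a₂ b₁ b₂ c₁ c₂ →
      (x₁ * a₂ - x₂ * a₁) * (b₁ * c₂ - b₂ * c₁)
        ≡ (b₁ * a₂ - b₂ * a₁) * (x₁ * c₂ - x₂ * c₁) - (c₁ * a₂ - c₂ * a₁) * (x₁ * b₂ - x₂ * b₁)
    identity′ = solve-∀ ℚ-ring

  partialFractions₂ : ∀ x a b c → det x b ≢ 0ℚ → det x c ≢ 0ℚ → det b c ≢ 0ℚ →
    det x a * det x b ⁻¹ * det x c ⁻¹
      ≡ det b a * det b c ⁻¹ * det x b ⁻¹ + det c a * det c b ⁻¹ * det x c ⁻¹
  partialFractions₂ x a b c u≢0 v≢0 w≢0 = begin
    det x a * u ⁻¹ * v ⁻¹
      ≡⟨ *-⁻¹-cancelʳ w≢0 (det x a * u ⁻¹ * v ⁻¹) ⟨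
    det x a * u ⁻¹ * v ⁻¹ * w * w ⁻¹
      ≡⟨ regroup (det x a) (u ⁻¹) (v ⁻¹) w (w ⁻¹) ⟩
    det x a * w * (u ⁻¹ * v ⁻¹ * w ⁻¹)
      ≡⟨ cong (_* (u ⁻¹ * v ⁻¹ * w ⁻¹)) (plücker x a b c) ⟩
    (det b a * v - det c a * u) * (u ⁻¹ * v ⁻¹ * w ⁻¹)
      ≡⟨ expand (det b a) (det c a) u v (u ⁻¹) (v ⁻¹) (w ⁻¹) ⟩
    det b a * w ⁻¹ * u ⁻¹ * v * v ⁻¹ - det c a * w ⁻¹ * v ⁻¹ * u * u ⁻¹
      ≡⟨ cong₂ _-_ (*-⁻¹-cancelʳ v≢0 (det b a * w ⁻¹ * u ⁻¹)) (*-⁻¹-cancelʳ u≢0 (det c a * w ⁻¹ * v ⁻¹)) ⟩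
    det b a * w ⁻¹ * u ⁻¹ - det c a * w ⁻¹ * v ⁻¹
      ≡⟨ move-neg (det b a * w ⁻¹ * u ⁻¹) (det c a) (w ⁻¹) (v ⁻¹) ⟩
    det b a * w ⁻¹ * u ⁻¹ + det c a * (- w ⁻¹) * v ⁻¹
      ≡⟨ cong (λ t → det b a * w ⁻¹ * u ⁻¹ + det c a * t * v ⁻¹)
              (trans (cong _⁻¹ (det-antisym b c)) (⁻¹-neg w)) ⟨
    det b a * w ⁻¹ * u ⁻¹ + det c a * det c b ⁻¹ * v ⁻¹
      ∎
    where
    u = det x b
    v = det x c
    w = det b c
    regroup : ∀ p s t w w′ → p * s * t * w * w′ ≡ p * w * (s * t * w′)
    regroup = solve-∀ ℚ-ring
    expand : ∀ p q u v s t r → (p * v - q * u) * (s * t * r) ≡ p * r * s * v * t - q * r * t * u * s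
    expand = solve-∀ ℚ-ring
    move-neg : ∀ y q r t → y - q * r * t ≡ y + q * (- r) * t
    move-neg = solve-∀ ℚ-ring

  detRatio : ∀ {m n} → (Fin m → Point) → (Fin n → Point) → Point → ℚ
  detRatio A B x = ∏ (λ i → det x (A i)) * ∏ (λ k → det x (B k)) ⁻¹

  detRatio-cons : ∀ {m n} (A : Fin (suc m) → Point) (B : Fin (suc n) → Point) x →
    detRatio A B x ≡ det x (A zero) * det x (B zero) ⁻¹ * detRatio (tail A) (tail B) x
  detRatio-cons A B x = begin
    a * P * (b * Q) ⁻¹       ≡⟨ cong (a * P *_) (⁻¹-distrib-* b Q) ⟩
    a * P * (b ⁻¹ * Q ⁻¹)    ≡⟨ interchange a P (b ⁻¹) (Q ⁻¹) ⟩
    a * b ⁻¹ * (P * Q ⁻¹)    ∎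
    where
    a = det x (A zero)
    b = det x (B zero)
    P = ∏ (λ i → det x (tail A i))
    Q = ∏ (λ k → det x (tail B k))
    interchange : ∀ a b c d → a * b * (c * d) ≡ a * c * (b * d)
    interchange = solve-∀ ℚ-ring

  -- Induction step: partialFractions₂ splits each term of the hypothesis into a pole at B zero and
  -- one at B (suc k); by the hypothesis at x = B zero, the former add up to the residue at B zero.
  partialFractions : ∀ n (A : Fin n → Point) (B : Fin (suc n) → Point) x →
    (∀ k → det x (B k) ≢ 0ℚ) → (∀ k l → k ≢ l → det (B k) (B l) ≢ 0ℚ) →
    detRatio A B x ≡ sum (λ k → detRatio A (removeAt B k) (B k) * det x (B k) ⁻¹)
  partialFractions zero A B x _ _ = begin
    1ℚ * (det x (B zero) * 1ℚ) ⁻¹ ≡⟨ cong (λ d → 1ℚ * d ⁻¹) (ℚ.*-identityʳ (det x (B zero))) ⟩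
    1ℚ * det x (B zero) ⁻¹        ≡⟨ padding (det x (B zero) ⁻¹) ⟩
    1ℚ * 1ℚ * det x (B zero) ⁻¹ + 0ℚ ∎
    where
    padding : ∀ y → 1ℚ * y ≡ 1ℚ * 1ℚ * y + 0ℚ
    padding = solve-∀ ℚ-ring
  partialFractions (suc n) A B x x≢B B≢B = begin
    detRatio A B x
      ≡⟨ detRatio-cons A B x ⟩
    det x a * u ⁻¹ * detRatio A′ B′ x
      ≡⟨ cong (det x a * u ⁻¹ *_) (partialFractions n A′ B′ x (x≢B ∘ suc) B′≢B′) ⟩
    det x a * u ⁻¹ * sum (λ k → residue′ k * d k ⁻¹)
      ≡⟨ *-distribˡ-sum (det x a * u ⁻¹) (λ k → residue′ k * d k ⁻¹) ⟩
    sum (λ k → det x a * u ⁻¹ * (residue′ k * d k ⁻¹))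
      ≡⟨ sum-cong-≗ split ⟩
    sum (λ k → c * (residue′ k * det b (B′ k) ⁻¹) + residue k * d k ⁻¹)
      ≡⟨ ∑-distrib-+ (λ k → c * (residue′ k * det b (B′ k) ⁻¹)) (λ k → residue k * d k ⁻¹) ⟩
    sum (λ k → c * (residue′ k * det b (B′ k) ⁻¹)) + rest
      ≡⟨ cong (_+ rest) (*-distribˡ-sum c (λ k → residue′ k * det b (B′ k) ⁻¹)) ⟨
    c * sum (λ k → residue′ k * det b (B′ k) ⁻¹) + rest
      ≡⟨ cong (λ t → c * t + rest) (partialFractions n A′ B′ b (λ k → B≢B zero (suc k) (λ ())) B′≢B′) ⟨
    c * detRatio A′ B′ b + rest
      ≡⟨ cong (_+ rest) first-residue ⟩
    detRatio A B′ b * u ⁻¹ + rest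
      ∎
    where
    a = A zero
    b = B zero
    A′ = tail A
    B′ = tail B
    u = det x b
    c = det b a * u ⁻¹
    d : Fin (suc n) → ℚ
    d k = det x (B′ k)
    residue′ residue : Fin (suc n) → ℚ
    residue′ k = detRatio A′ (removeAt B′ k) (B′ k)
    residue k = detRatio A (removeAt B (suc k)) (B′ k)
    rest = sum (λ k → residue k * d k ⁻¹)
    B′≢B′ : ∀ k l → k ≢ l → det (B′ k) (B′ l) ≢ 0ℚ
    B′≢B′ k l k≢l = B≢B (suc k) (suc l) (k≢l ∘ Fin.suc-injective)
    first-residue : c * detRatio A′ B′ b ≡ detRatio A B′ b * u ⁻¹
    first-residue = trans (rotate (det b a) (u ⁻¹) (detRatio A′ B′ b))
                          (cong (_* u ⁻¹) (sym (ℚ.*-assoc (det b a) _ _)))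
      where
      rotate : ∀ p q r → p * q * r ≡ p * r * q
      rotate = solve-∀ ℚ-ring
    split : ∀ k → det x a * u ⁻¹ * (residue′ k * d k ⁻¹) ≡ c * (residue′ k * det b (B′ k) ⁻¹) + residue k * d k ⁻¹
    split k = begin
      det x a * u ⁻¹ * (residue′ k * d k ⁻¹)
        ≡⟨ factor (det x a) (u ⁻¹) (residue′ k) (d k ⁻¹) ⟩
      det x a * u ⁻¹ * d k ⁻¹ * residue′ k
        ≡⟨ cong (_* residue′ k) (partialFractions₂ x a b (B′ k) (x≢B zero) (x≢B (suc k)) (B≢B zero (suc k) (λ ()))) ⟩
      (det b a * det b (B′ k) ⁻¹ * u ⁻¹ + det (B′ k) a * det (B′ k) b ⁻¹ * d k ⁻¹) * residue′ k
        ≡⟨ distribute (det b a) (det b (B′ k) ⁻¹) (u ⁻¹) (det (B′ k) a) (det (B′ k) b ⁻¹) (d k ⁻¹) (residue′ k) ⟩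
      c * (residue′ k * det b (B′ k) ⁻¹) + det (B′ k) a * det (B′ k) b ⁻¹ * residue′ k * d k ⁻¹
        ≡⟨ cong (λ t → c * (residue′ k * det b (B′ k) ⁻¹) + t * d k ⁻¹)
             (sym (detRatio-cons A (removeAt B (suc k)) (B′ k))) ⟩
      c * (residue′ k * det b (B′ k) ⁻¹) + residue k * d k ⁻¹
        ∎
      where
      factor : ∀ p q t r → p * q * (t * r) ≡ p * q * r * t
      factor = solve-∀ ℚ-ring
      distribute : ∀ p q r s t v w → (p * q * r + s * t * v) * w ≡ p * r * (w * q) + s * t * w * v
      distribute = solve-∀ ℚ-ring

  -- Fibonacci numbers

  -- fibℚ m = (+ fib m) / 1 goes through the normalising _/_, so its recurrence in ℚ needs a proof.
  /1≡mkℚ : ∀ m → (+ m) ℚ./ 1 ≡ mkℚ (+ m) 0 (Coprimality.sym (Coprimality.1-coprimeTo m))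
  /1≡mkℚ m = ℚ.normalize-coprime (Coprimality.sym (Coprimality.1-coprimeTo m))

  /1-homo-+ : ∀ a b → (+ (a ℕ.+ b)) ℚ./ 1 ≡ (+ a) ℚ./ 1 + (+ b) ℚ./ 1
  /1-homo-+ a b rewrite /1≡mkℚ a | /1≡mkℚ b | /1≡mkℚ (a ℕ.+ b) =
    ℚ.toℚᵘ-injective (ℚᵘ.≃-sym (ℚᵘ.≃-trans (ℚ.toℚᵘ-homo-+ (a/1 a) (a/1 b)) (ℚᵘ.*≡* numerators)))
    where
    a/1 : ℕ → ℚ
    a/1 m = mkℚ (+ m) 0 (Coprimality.sym (Coprimality.1-coprimeTo m))
    numerators : ((+ a) ℤ.* (+ 1) ℤ.+ (+ b) ℤ.* (+ 1)) ℤ.* (+ 1) ≡ (+ (a ℕ.+ b)) ℤ.* (+ 1)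
    numerators = cong (ℤ._* + 1) (cong₂ ℤ._+_ (ℤ.*-identityʳ (+ a)) (ℤ.*-identityʳ (+ b)))

  fibℚ-suc-suc : ∀ n → fibℚ (suc (suc n)) ≡ fibℚ (suc n) + fibℚ n
  fibℚ-suc-suc n = /1-homo-+ (fib (suc n)) (fib n)

  fib-suc>0 : ∀ n → 0 < fib (suc n)
  fib-suc>0 zero    = ℕ.s≤s ℕ.z≤n
  fib-suc>0 (suc n) = ℕ.<-≤-trans (fib-suc>0 n) (ℕ.m≤m+n (fib (suc n)) (fib n))

  fibℚ≢0 : ∀ {n} → 0 < n → fibℚ n ≢ 0ℚ
  fibℚ≢0 {suc n} _ fibℚ≡0 with fib (suc n) | fib-suc>0 n | trans (sym (/1≡mkℚ (fib (suc n)))) fibℚ≡0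
  ... | suc _ | _ | ()

  invFib≡fibℚ⁻¹ : ∀ n → invFib n ≡ fibℚ n ⁻¹
  invFib≡fibℚ⁻¹ n with fib n
  ... | zero  = refl
  ... | suc m rewrite /1≡mkℚ (suc m) = ℚ.normalize-coprime _

  fibℚ-+ : ∀ i t → fibℚ (suc i) * fibℚ (suc t) + fibℚ i * fibℚ t ≡ fibℚ (suc (i ℕ.+ t))
  fibℚ-+ zero    t = base (fibℚ (suc t)) (fibℚ t)
    where
    base : ∀ x y → 1ℚ * x + 0ℚ * y ≡ x
    base = solve-∀ ℚ-ring
  fibℚ-+ (suc i) t = begin
    fibℚ (suc (suc i)) * fibℚ (suc t) + fibℚ (suc i) * fibℚ t
      ≡⟨ cong (λ f → f * fibℚ (suc t) + fibℚ (suc i) * fibℚ t) (fibℚ-suc-suc i) ⟩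
    (fibℚ (suc i) + fibℚ i) * fibℚ (suc t) + fibℚ (suc i) * fibℚ t
      ≡⟨ shift (fibℚ (suc i)) (fibℚ i) (fibℚ (suc t)) (fibℚ t) ⟩
    fibℚ (suc i) * (fibℚ (suc t) + fibℚ t) + fibℚ i * fibℚ (suc t)
      ≡⟨ cong (λ f → fibℚ (suc i) * f + fibℚ i * fibℚ (suc t)) (fibℚ-suc-suc t) ⟨
    fibℚ (suc i) * fibℚ (suc (suc t)) + fibℚ i * fibℚ (suc t)
      ≡⟨ fibℚ-+ i (suc t) ⟩
    fibℚ (suc (i ℕ.+ suc t))
      ≡⟨ cong (fibℚ ∘ suc) (ℕ.+-suc i t) ⟩
    fibℚ (suc (suc i ℕ.+ t))
      ∎
    where
    shift : ∀ a b c d → (a + b) * c + a * d ≡ a * (c + d) + b * c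
    shift = solve-∀ ℚ-ring

  d'Ocagne : ∀ q d → fibℚ (suc (q ℕ.+ d)) * fibℚ q - fibℚ (q ℕ.+ d) * fibℚ (suc q) ≡ sign (suc q) * fibℚ d
  d'Ocagne zero    d = base (fibℚ (suc d)) (fibℚ d)
    where
    base : ∀ x y → x * 0ℚ - y * 1ℚ ≡ (- 1ℚ) * y
    base = solve-∀ ℚ-ring
  d'Ocagne (suc q) d = begin
    fibℚ (suc (suc (q ℕ.+ d))) * fibℚ (suc q) - fibℚ (suc (q ℕ.+ d)) * fibℚ (suc (suc q))
      ≡⟨ cong₂ (λ f g → f * fibℚ (suc q) - fibℚ (suc (q ℕ.+ d)) * g) (fibℚ-suc-suc (q ℕ.+ d)) (fibℚ-suc-suc q) ⟩
    (fibℚ (suc (q ℕ.+ d)) + fibℚ (q ℕ.+ d)) * fibℚ (suc q) - fibℚ (suc (q ℕ.+ d)) * (fibℚ (suc q) + fibℚ q)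
      ≡⟨ shift (fibℚ (suc (q ℕ.+ d))) (fibℚ (q ℕ.+ d)) (fibℚ (suc q)) (fibℚ q) ⟩
    - (fibℚ (suc (q ℕ.+ d)) * fibℚ q - fibℚ (q ℕ.+ d) * fibℚ (suc q))
      ≡⟨ cong -_ (d'Ocagne q d) ⟩
    - (sign (suc q) * fibℚ d)
      ≡⟨ ℚ.neg-distribˡ-* (sign (suc q)) (fibℚ d) ⟩
    sign (suc (suc q)) * fibℚ d
      ∎
    where
    shift : ∀ a b c d → (a + b) * c - a * (c + d) ≡ - (a * d - b * c)
    shift = solve-∀ ℚ-ring

  U : ℕ → Point
  U i = fibℚ (suc i) , fibℚ i

  V : ℕ → Point
  V m = - fibℚ m , fibℚ (suc m)

  det-U-V : ∀ i m → det (U i) (V m) ≡ fibℚ (suc (i ℕ.+ m))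
  det-U-V i m = trans (sub-neg (fibℚ (suc i)) (fibℚ (suc m)) (fibℚ i) (fibℚ m)) (fibℚ-+ i m)
    where
    sub-neg : ∀ a b c d → a * b - c * (- d) ≡ a * b + c * d
    sub-neg = solve-∀ ℚ-ring

  neg-d'Ocagne : ∀ x d → - (fibℚ (suc (x ℕ.+ d)) * fibℚ x - fibℚ (x ℕ.+ d) * fibℚ (suc x)) ≡ sign x * fibℚ d
  neg-d'Ocagne x d = trans (cong -_ (d'Ocagne x d)) (neg-neg (sign x) (fibℚ d))
    where
    neg-neg : ∀ s f → - ((- s) * f) ≡ s * f
    neg-neg = solve-∀ ℚ-ring

  det-U-U : ∀ x d → det (U x) (U (x ℕ.+ d)) ≡ sign x * fibℚ d
  det-U-U x d = trans (flip (fibℚ (suc x)) (fibℚ (x ℕ.+ d)) (fibℚ x) (fibℚ (suc (x ℕ.+ d)))) (neg-d'Ocagne x d)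
    where
    flip : ∀ a b c e → a * b - c * e ≡ - (e * c - b * a)
    flip = solve-∀ ℚ-ring

  det-V-V : ∀ x d → det (V x) (V (x ℕ.+ d)) ≡ sign x * fibℚ d
  det-V-V x d = trans (flip (fibℚ x) (fibℚ (suc (x ℕ.+ d))) (fibℚ (suc x)) (fibℚ (x ℕ.+ d))) (neg-d'Ocagne x d)
    where
    flip : ∀ a b c e → (- a) * b - c * (- e) ≡ - (b * a - e * c)
    flip = solve-∀ ℚ-ring

  fibonorial : ℕ → ℚ
  fibonorial r = ∏< r (fibℚ ∘ suc)

  spacingExp : ℕ → ℕ → ℕ → ℕ
  spacingExp c k r = k ℕ.* suc c ℕ.+ k C 2 ℕ.+ r ℕ.* (c ℕ.+ k)

  module FibonacciSpaced (P : ℕ → Point) (c : ℕ)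
    (spacing : ∀ x d → det (P x) (P (x ℕ.+ d)) ≡ sign (c ℕ.+ x) * fibℚ d) where

    det-<-≢0 : ∀ {x y} → x < y → det (P x) (P y) ≢ 0ℚ
    det-<-≢0 {x} {y} x<y = subst (λ z → det (P x) (P z) ≢ 0ℚ) (ℕ.m+[n∸m]≡n (ℕ.<⇒≤ x<y))
      (subst (_≢ 0ℚ) (sym (spacing x (y ∸ x))) (*-≢0 (sign-≢0 (c ℕ.+ x)) (fibℚ≢0 (ℕ.m<n⇒0<n∸m x<y))))

    det-≢0 : ∀ {x y} → x ≢ y → det (P x) (P y) ≢ 0ℚ
    det-≢0 {x} {y} x≢y with ℕ.<-cmp x y
    ... | tri< x<y _   _ = det-<-≢0 x<y
    ... | tri≈ _   x≡y _ = ⊥-elim (x≢y x≡y)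
    ... | tri> _   _ y<x = λ det≡0 →
      det-<-≢0 y<x (ℚ.neg-injective (trans (sym (det-antisym (P y) (P x))) det≡0))

    ∏-det-below : ∀ k → ∏< k (λ l → det (P k) (P l)) ≡ sign (k ℕ.* suc c ℕ.+ k C 2) * fibonorial k
    ∏-det-below k = begin
      ∏< k (λ l → det (P k) (P l))
        ≡⟨ ∏<-cong k below ⟩
      ∏< k (λ l → sign (suc c ℕ.+ l) * fibℚ (k ∸ l))
        ≡⟨ ∏-distrib-* {k} (λ l → sign (suc c ℕ.+ toℕ l)) (λ l → fibℚ (k ∸ toℕ l)) ⟩
      ∏< k (λ l → sign (suc c ℕ.+ l)) * ∏< k (λ l → fibℚ (k ∸ l))
        ≡⟨ cong₂ _*_ (∏<-sign-+ k (suc c)) reversed ⟩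
      sign (k ℕ.* suc c ℕ.+ k C 2) * fibonorial k
        ∎
      where
      below : ∀ l → l < k → det (P k) (P l) ≡ sign (suc c ℕ.+ l) * fibℚ (k ∸ l)
      below l l<k = begin
        det (P k) (P l)                    ≡⟨ cong (λ m → det (P m) (P l)) (ℕ.m+[n∸m]≡n (ℕ.<⇒≤ l<k)) ⟨
        det (P (l ℕ.+ (k ∸ l))) (P l)      ≡⟨ det-antisym (P l) (P (l ℕ.+ (k ∸ l))) ⟩
        - det (P l) (P (l ℕ.+ (k ∸ l)))    ≡⟨ cong -_ (spacing l (k ∸ l)) ⟩
        - (sign (c ℕ.+ l) * fibℚ (k ∸ l))  ≡⟨ ℚ.neg-distribˡ-* (sign (c ℕ.+ l)) (fibℚ (k ∸ l)) ⟩
        sign (suc c ℕ.+ l) * fibℚ (k ∸ l)  ∎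
      reversed : ∏< k (λ l → fibℚ (k ∸ l)) ≡ fibonorial k
      reversed = trans (∏<-cong k {g = λ l → fibℚ (suc (k ∸ suc l))} (λ l l<k → cong fibℚ (ℕ.+-∸-assoc 1 l<k)))
                       (∏<-reverse k (fibℚ ∘ suc))

    ∏-det-above : ∀ k r → ∏< r (λ l → det (P k) (P (suc k ℕ.+ l))) ≡ sign (r ℕ.* (c ℕ.+ k)) * fibonorial r
    ∏-det-above k r = begin
      ∏< r (λ l → det (P k) (P (suc k ℕ.+ l)))
        ≡⟨ ∏<-cong r (λ l _ → trans (cong (det (P k) ∘ P) (sym (ℕ.+-suc k l))) (spacing k (suc l))) ⟩
      ∏< r (λ l → sign (c ℕ.+ k) * fibℚ (suc l))
        ≡⟨ ∏-distrib-* {r} (λ _ → sign (c ℕ.+ k)) (λ l → fibℚ (suc (toℕ l))) ⟩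
      ∏< r (λ _ → sign (c ℕ.+ k)) * fibonorial r
        ≡⟨ cong (_* fibonorial r) (∏<-sign r (c ℕ.+ k)) ⟩
      sign (r ℕ.* (c ℕ.+ k)) * fibonorial r
        ∎

    ∏-det-removeAt : ∀ n (k : Fin (suc n)) →
      ∏ (λ l → det (P (toℕ k)) (P (toℕ (punchIn k l))))
        ≡ sign (spacingExp c (toℕ k) (n ∸ toℕ k)) * (fibonorial (toℕ k) * fibonorial (n ∸ toℕ k))
    ∏-det-removeAt n k = begin
      ∏ (λ l → det (P kn) (P (toℕ (punchIn k l))))
        ≡⟨ ∏-removeAt n k (λ m → det (P kn) (P m)) ⟩
      ∏< kn (λ l → det (P kn) (P l)) * ∏< r (λ l → det (P kn) (P (suc kn ℕ.+ l)))
        ≡⟨ cong₂ _*_ (∏-det-below kn) (∏-det-above kn r) ⟩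
      sign e₁ * fibonorial kn * (sign e₂ * fibonorial r)
        ≡⟨ interchange (sign e₁) (fibonorial kn) (sign e₂) (fibonorial r) ⟩
      sign e₁ * sign e₂ * (fibonorial kn * fibonorial r)
        ≡⟨ cong (_* (fibonorial kn * fibonorial r)) (sign-+ e₁ e₂) ⟨
      sign (spacingExp c kn r) * (fibonorial kn * fibonorial r)
        ∎
      where
      kn = toℕ k
      r = n ∸ toℕ k
      e₁ = kn ℕ.* suc c ℕ.+ kn C 2
      e₂ = r ℕ.* (c ℕ.+ kn)
      interchange : ∀ a b c d → a * b * (c * d) ≡ a * c * (b * d)
      interchange = solve-∀ ℚ-ring

  -- Fibonomial coefficients

  fibonomial≡∏< : ∀ m r → fibonomial m r ≡ ∏< r (λ l → fibℚ (m ∸ l) * fibℚ (suc l) ⁻¹)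
  fibonomial≡∏< m zero    = refl
  fibonomial≡∏< m (suc r) = begin
    fibonomial m r * (fibℚ (m ∸ r) * invFib (suc r))
      ≡⟨ cong₂ (λ p q → p * (fibℚ (m ∸ r) * q)) (fibonomial≡∏< m r) (invFib≡fibℚ⁻¹ (suc r)) ⟩
    ∏< r (λ l → fibℚ (m ∸ l) * fibℚ (suc l) ⁻¹) * (fibℚ (m ∸ r) * fibℚ (suc r) ⁻¹)
      ≡⟨ ∏<-suc r (λ l → fibℚ (m ∸ l) * fibℚ (suc l) ⁻¹) ⟨
    ∏< (suc r) (λ l → fibℚ (m ∸ l) * fibℚ (suc l) ⁻¹)
      ∎

  fibonomial-rising : ∀ c r → fibonomial (c ℕ.+ r) r ≡ ∏< r (λ l → fibℚ (suc c ℕ.+ l)) * fibonorial r ⁻¹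
  fibonomial-rising c r = begin
    fibonomial (c ℕ.+ r) r
      ≡⟨ fibonomial≡∏< (c ℕ.+ r) r ⟩
    ∏< r (λ l → fibℚ (c ℕ.+ r ∸ l) * fibℚ (suc l) ⁻¹)
      ≡⟨ ∏-distrib-* {r} (λ l → fibℚ (c ℕ.+ r ∸ toℕ l)) (λ l → fibℚ (suc (toℕ l)) ⁻¹) ⟩
    ∏< r (λ l → fibℚ (c ℕ.+ r ∸ l)) * ∏< r (λ l → fibℚ (suc l) ⁻¹)
      ≡⟨ cong₂ _*_ falling (sym (∏-⁻¹ {r} (fibℚ ∘ suc ∘ toℕ))) ⟩
    ∏< r (λ l → fibℚ (suc c ℕ.+ l)) * fibonorial r ⁻¹
      ∎
    where
    index : ∀ l → l < r → c ℕ.+ r ∸ l ≡ suc c ℕ.+ (r ∸ suc l)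
    index l l<r = begin
      c ℕ.+ r ∸ l           ≡⟨ ℕ.+-∸-assoc c (ℕ.<⇒≤ l<r) ⟩
      c ℕ.+ (r ∸ l)         ≡⟨ cong (c ℕ.+_) (ℕ.+-∸-assoc 1 l<r) ⟩
      c ℕ.+ suc (r ∸ suc l) ≡⟨ ℕ.+-suc c (r ∸ suc l) ⟩
      suc c ℕ.+ (r ∸ suc l) ∎
    falling : ∏< r (λ l → fibℚ (c ℕ.+ r ∸ l)) ≡ ∏< r (λ l → fibℚ (suc c ℕ.+ l))
    falling = trans (∏<-cong r {g = λ l → fibℚ (suc c ℕ.+ (r ∸ suc l))} (λ l l<r → cong fibℚ (index l l<r)))
                    (∏<-reverse r (λ l → fibℚ (suc c ℕ.+ l)))

  fibProdExcept : ℕ → ∀ {n} → Fin (suc n) → ℚ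
  fibProdExcept c j = ∏ (λ m → fibℚ (c ℕ.+ toℕ (punchIn j m)))

  fibonomial-pair : ∀ c n (j : Fin (suc n)) →
    fibonomial (suc c ℕ.+ n) (n ∸ toℕ j) * fibonomial (c ℕ.+ toℕ j) (toℕ j)
      ≡ fibProdExcept (suc c) j * (fibonorial (toℕ j) * fibonorial (n ∸ toℕ j)) ⁻¹
  fibonomial-pair c n j = begin
    fibonomial (suc c ℕ.+ n) r * fibonomial (c ℕ.+ jn) jn
      ≡⟨ cong₂ _*_ (trans (cong (λ m → fibonomial m r) top) (fibonomial-rising (suc c ℕ.+ jn) r))
                   (fibonomial-rising c jn) ⟩
    above * fibonorial r ⁻¹ * (below * fibonorial jn ⁻¹)
      ≡⟨ regroup above (fibonorial r ⁻¹) below (fibonorial jn ⁻¹) ⟩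
    below * above * (fibonorial jn ⁻¹ * fibonorial r ⁻¹)
      ≡⟨ cong₂ _*_ except (sym (⁻¹-distrib-* (fibonorial jn) (fibonorial r))) ⟩
    fibProdExcept (suc c) j * (fibonorial jn * fibonorial r) ⁻¹
      ∎
    where
    jn = toℕ j
    r = n ∸ toℕ j
    below = ∏< jn (λ l → fibℚ (suc c ℕ.+ l))
    above = ∏< r (λ l → fibℚ (suc (suc c ℕ.+ jn) ℕ.+ l))
    top : suc c ℕ.+ n ≡ suc c ℕ.+ jn ℕ.+ r
    top = trans (cong (suc c ℕ.+_) (sym (ℕ.m+[n∸m]≡n (Fin.toℕ≤pred[n] j)))) (sym (ℕ.+-assoc (suc c) jn r))
    shift : ∀ c j l → suc c ℕ.+ (suc j ℕ.+ l) ≡ suc (suc c ℕ.+ j) ℕ.+ l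
    shift = ℕ-Solver.solve-∀
    except : below * above ≡ fibProdExcept (suc c) j
    except = sym (trans (∏-removeAt n j (λ m → fibℚ (suc c ℕ.+ m)))
                        (cong (below *_) (∏<-cong r (λ l _ → cong fibℚ (shift c jn l)))))
    regroup : ∀ p q s t → p * q * (s * t) ≡ s * p * (t * q)
    regroup = solve-∀ ℚ-ring

  -- Both k + r and j + q stand for n; substituting them into different occurrences of n
  -- turns the claim into a polynomial identity.
  filbert-parity : ∀ a n k r j q → k ℕ.+ r ≡ n → j ℕ.+ q ≡ n →
    n ℕ.* (suc a ℕ.+ k ℕ.+ j) ℕ.+ k C 2 ℕ.+ j C 2 ℕ.+ (k ℕ.+ j)
      ≡ n ℕ.+ spacingExp a k r ℕ.+ spacingExp 0 j q ℕ.+ (k ℕ.* k ℕ.+ j ℕ.* j)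
  filbert-parity a .(k ℕ.+ r) k r j q refl j+q≡n = begin
    (k ℕ.+ r) ℕ.* (suc a ℕ.+ k ℕ.+ j) ℕ.+ k C 2 ℕ.+ j C 2 ℕ.+ (k ℕ.+ j)
      ≡⟨ distrib a k r j (k C 2) (j C 2) ⟩
    (k ℕ.+ r) ℕ.* (suc a ℕ.+ k) ℕ.+ (k ℕ.+ r) ℕ.* j ℕ.+ k C 2 ℕ.+ j C 2 ℕ.+ (k ℕ.+ j)
      ≡⟨ cong (λ m → (k ℕ.+ r) ℕ.* (suc a ℕ.+ k) ℕ.+ m ℕ.* j ℕ.+ k C 2 ℕ.+ j C 2 ℕ.+ (k ℕ.+ j)) (sym j+q≡n) ⟩
    (k ℕ.+ r) ℕ.* (suc a ℕ.+ k) ℕ.+ (j ℕ.+ q) ℕ.* j ℕ.+ k C 2 ℕ.+ j C 2 ℕ.+ (k ℕ.+ j)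
      ≡⟨ expand a k r j q (k C 2) (j C 2) ⟩
    k ℕ.+ r ℕ.+ spacingExp a k r ℕ.+ spacingExp 0 j q ℕ.+ (k ℕ.* k ℕ.+ j ℕ.* j)
      ∎
    where
    distrib : ∀ a k r j x y →
      (k ℕ.+ r) ℕ.* (suc a ℕ.+ k ℕ.+ j) ℕ.+ x ℕ.+ y ℕ.+ (k ℕ.+ j)
        ≡ (k ℕ.+ r) ℕ.* (suc a ℕ.+ k) ℕ.+ (k ℕ.+ r) ℕ.* j ℕ.+ x ℕ.+ y ℕ.+ (k ℕ.+ j)
    distrib = ℕ-Solver.solve-∀
    expand : ∀ a k r j q x y →
      (k ℕ.+ r) ℕ.* (suc a ℕ.+ k) ℕ.+ (j ℕ.+ q) ℕ.* j ℕ.+ x ℕ.+ y ℕ.+ (k ℕ.+ j)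
        ≡ k ℕ.+ r ℕ.+ (k ℕ.* suc a ℕ.+ x ℕ.+ r ℕ.* (a ℕ.+ k)) ℕ.+ (j ℕ.* 1 ℕ.+ y ℕ.+ q ℕ.* (0 ℕ.+ j))
            ℕ.+ (k ℕ.* k ℕ.+ j ℕ.* j)
    expand = ℕ-Solver.solve-∀

  -- The exponents differ by (k² - k) + (j² - j), which is even.
  filbert-sign : ∀ a n k j → k ≤ n → j ≤ n →
    negOnePow ((+ (n ℕ.* (suc a ℕ.+ k ℕ.+ j)) ℤ.- + (k C 2)) ℤ.- + (j C 2))
      ≡ sign n * sign (spacingExp a k (n ∸ k)) * sign (spacingExp 0 j (n ∸ j))
  filbert-sign a n k j k≤n j≤n = begin
    negOnePow ((+ x ℤ.- + (k C 2)) ℤ.- + (j C 2))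
      ≡⟨ negOnePow[x-b-c]≡sign[x+b+c] x (k C 2) (j C 2) ⟩
    sign (x ℕ.+ k C 2 ℕ.+ j C 2)
      ≡⟨ sign-cancelʳ (x ℕ.+ k C 2 ℕ.+ j C 2) (n ℕ.+ eₖ ℕ.+ eⱼ) (k ℕ.+ j) same-parity ⟩
    sign (n ℕ.+ eₖ ℕ.+ eⱼ)
      ≡⟨ trans (sign-+ (n ℕ.+ eₖ) eⱼ) (cong (_* sign eⱼ) (sign-+ n eₖ)) ⟩
    sign n * sign eₖ * sign eⱼ
      ∎
    where
    x = n ℕ.* (suc a ℕ.+ k ℕ.+ j)
    eₖ = spacingExp a k (n ∸ k)
    eⱼ = spacingExp 0 j (n ∸ j)
    same-parity : sign (x ℕ.+ k C 2 ℕ.+ j C 2 ℕ.+ (k ℕ.+ j)) ≡ sign (n ℕ.+ eₖ ℕ.+ eⱼ ℕ.+ (k ℕ.+ j))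
    same-parity = trans (cong sign (filbert-parity a n k (n ∸ k) j (n ∸ j) (ℕ.m+[n∸m]≡n k≤n) (ℕ.m+[n∸m]≡n j≤n)))
                        (sign-+-squares (n ℕ.+ eₖ ℕ.+ eⱼ) k j)

  -- The Filbert matrix and its inverse

  filbert : ℕ → (n : ℕ) → Matrix (suc n)
  filbert α n i j = invFib (α ℕ.+ toℕ i ℕ.+ toℕ j)

  filbertInverse : ℕ → (n : ℕ) → Matrix (suc n)
  filbertInverse α n i j =
    negOnePow ((+ (n ℕ.* (α ℕ.+ toℕ i ℕ.+ toℕ j)) ℤ.- + (toℕ i C 2)) ℤ.- + (toℕ j C 2))
    * fibℚ (α ℕ.+ toℕ i ℕ.+ toℕ j)
    * fibonomial (α ℕ.+ n ℕ.+ toℕ i) (n ∸ toℕ j)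
    * fibonomial (α ℕ.+ n ℕ.+ toℕ j) (n ∸ toℕ i)
    * fibonomial (α ℕ.+ toℕ i ℕ.+ toℕ j ∸ 1) (toℕ i)
    * fibonomial (α ℕ.+ toℕ i ℕ.+ toℕ j ∸ 1) (toℕ j)

  identity-refl : ∀ {m} (i : Fin m) → identity i i ≡ 1ℚ
  identity-refl i with i Fin.≟ i
  ... | yes _   = refl
  ... | no  i≢i = ⊥-elim (i≢i refl)

  identity-≢ : ∀ {m} {i j : Fin m} → i ≢ j → identity i j ≡ 0ℚ
  identity-≢ {i = i} {j} i≢j with i Fin.≟ j
  ... | yes i≡j = ⊥-elim (i≢j i≡j)
  ... | no  _   = refl

  normalised-delta : ∀ {m} (j : Fin m) (f : Fin m → ℚ) → f j ≢ 0ℚ → (∀ {i} → i ≢ j → f i ≡ 0ℚ) →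
    ∀ i → f j ⁻¹ * f i ≡ identity i j
  normalised-delta j f fj≢0 f-vanishes i with toSum (i Fin.≟ j)
  ... | inj₁ refl = trans (⁻¹-inverseˡ fj≢0) (sym (identity-refl j))
  ... | inj₂ i≢j  = trans (cong (f j ⁻¹ *_) (f-vanishes i≢j)) (trans (ℚ.*-zeroʳ (f j ⁻¹)) (sym (identity-≢ i≢j)))

  module FilbertInverse (a n : ℕ) where

    Us : Fin (suc n) → Point
    Us = U ∘ toℕ

    Vs : Fin (suc n) → Point
    Vs k = V (a ℕ.+ toℕ k)

    det-V-V-shifted : ∀ x d → det (V (a ℕ.+ x)) (V (a ℕ.+ (x ℕ.+ d))) ≡ sign (a ℕ.+ x) * fibℚ d
    det-V-V-shifted x d = trans (cong (det (V (a ℕ.+ x)) ∘ V) (sym (ℕ.+-assoc a x d))) (det-V-V (a ℕ.+ x) d)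

    open FibonacciSpaced U 0 det-U-U using ()
      renaming (det-≢0 to det-U-≢0; ∏-det-removeAt to ∏-det-U-removeAt)
    open FibonacciSpaced (V ∘ (a ℕ.+_)) a det-V-V-shifted using ()
      renaming (det-≢0 to det-V-≢0; ∏-det-removeAt to ∏-det-V-removeAt)

    det-Us-Vs : ∀ i k → det (Us i) (Vs k) ≡ fibℚ (suc a ℕ.+ toℕ i ℕ.+ toℕ k)
    det-Us-Vs i k = trans (det-U-V (toℕ i) (a ℕ.+ toℕ k)) (cong (fibℚ ∘ suc) (shuffle (toℕ i) a (toℕ k)))
      where
      shuffle : ∀ i a k → i ℕ.+ (a ℕ.+ k) ≡ a ℕ.+ i ℕ.+ k
      shuffle = ℕ-Solver.solve-∀

    Us≢Vs : ∀ i k → det (Us i) (Vs k) ≢ 0ℚ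
    Us≢Vs i k = subst (_≢ 0ℚ) (sym (det-Us-Vs i k)) (fibℚ≢0 {suc a ℕ.+ toℕ i ℕ.+ toℕ k} (ℕ.s≤s ℕ.z≤n))

    Vs≢Vs : ∀ k l → k ≢ l → det (Vs k) (Vs l) ≢ 0ℚ
    Vs≢Vs k l k≢l = det-V-≢0 (k≢l ∘ Fin.toℕ-injective)

    lagrangeBasis : Fin (suc n) → Point → ℚ
    lagrangeBasis j = detRatio (removeAt Us j) Vs

    lagrangeBasis-vanishes : ∀ {i j} → i ≢ j → lagrangeBasis j (Us i) ≡ 0ℚ
    lagrangeBasis-vanishes {i} {j} i≢j =
      trans (cong (_* ∏ (λ k → det (Us i) (Vs k)) ⁻¹) (∏-zero _ (punchOut j≢i) Us-i-removed))
            (ℚ.*-zeroˡ (∏ (λ k → det (Us i) (Vs k)) ⁻¹))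
      where
      j≢i = i≢j ∘ sym
      Us-i-removed : det (Us i) (Us (punchIn j (punchOut j≢i))) ≡ 0ℚ
      Us-i-removed = trans (cong (det (Us i) ∘ Us) (Fin.punchIn-punchOut j≢i)) (det-self (Us i))

    lagrangeBasis-≢0 : ∀ j → lagrangeBasis j (Us j) ≢ 0ℚ
    lagrangeBasis-≢0 j = *-≢0 (∏-≢0 _ (λ m → det-U-≢0 (λ eq → Fin.punchInᵢ≢i j m (Fin.toℕ-injective (sym eq)))))
                      (⁻¹-≢0 (∏-≢0 _ (Us≢Vs j)))

    det-Vs-U : ∀ k m → det (Vs k) (U m) ≡ - fibℚ (suc a ℕ.+ toℕ k ℕ.+ m)
    det-Vs-U k m =
      trans (det-antisym (U m) (Vs k)) (cong -_ (trans (det-U-V m (a ℕ.+ toℕ k)) (cong (fibℚ ∘ suc) (shuffle m a (toℕ k)))))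
      where
      shuffle : ∀ m a k → m ℕ.+ (a ℕ.+ k) ≡ a ℕ.+ k ℕ.+ m
      shuffle = ℕ-Solver.solve-∀

    residue : Fin (suc n) → Fin (suc n) → ℚ
    residue j k = detRatio (removeAt Us j) (removeAt Vs k) (Vs k)

    residue-closed : ∀ j k →
      residue j k ≡ sign n * fibProdExcept (suc a ℕ.+ toℕ k) j
                    * (sign (spacingExp a (toℕ k) (n ∸ toℕ k)) * (fibonorial (toℕ k) * fibonorial (n ∸ toℕ k))) ⁻¹
    residue-closed j k = cong₂ (λ p q → p * q ⁻¹) numerator (∏-det-V-removeAt n k)
      where
      numerator : ∏ (λ m → det (Vs k) (Us (punchIn j m))) ≡ sign n * fibProdExcept (suc a ℕ.+ toℕ k) j
      numerator = trans (∏-cong (λ m → det-Vs-U k (toℕ (punchIn j m))))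
                        (∏-neg (λ m → fibℚ (suc a ℕ.+ toℕ k ℕ.+ toℕ (punchIn j m))))

    lagrangeBasis-closed : ∀ (j k : Fin (suc n)) →
      lagrangeBasis j (Us j) ≡ sign (spacingExp 0 (toℕ j) (n ∸ toℕ j)) * (fibonorial (toℕ j) * fibonorial (n ∸ toℕ j))
                               * (fibℚ (suc a ℕ.+ toℕ j ℕ.+ toℕ k) * fibProdExcept (suc a ℕ.+ toℕ j) k) ⁻¹
    lagrangeBasis-closed j k = cong₂ (λ p q → p * q ⁻¹) (∏-det-U-removeAt n j)
      (trans (∏-cong (det-Us-Vs j)) (∏-remove {i = k} (λ k′ → fibℚ (suc a ℕ.+ toℕ j ℕ.+ toℕ k′))))

    filbertInverse-entry : ∀ k j → filbertInverse (suc a) n k j ≡ residue j k * lagrangeBasis j (Us j) ⁻¹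
    filbertInverse-entry k j = begin
      σ * F * b₁ * b₂ * b₃ * b₄
        ≡⟨ regroup σ F b₁ b₂ b₃ b₄ ⟩
      σ * F * (b₁ * b₄) * (b₂ * b₃)
        ≡⟨ cong₂ (λ s t → σ * F * s * t) pairₖ pairⱼ ⟩
      σ * F * (Pₖ * Y ⁻¹) * (Pⱼ * X ⁻¹)
        ≡⟨ cong₂ (λ s f → s * f * (Pₖ * Y ⁻¹) * (Pⱼ * X ⁻¹))
                 (filbert-sign a n kn jn (Fin.toℕ≤pred[n] k) (Fin.toℕ≤pred[n] j))
                 (cong (fibℚ ∘ suc) (+-right-comm a kn jn)) ⟩
      sign n * sign eₖ * sign eⱼ * F′ * (Pₖ * Y ⁻¹) * (Pⱼ * X ⁻¹)
        ≡⟨ rearrange (sign n) (sign eₖ) (sign eⱼ) F′ Pₖ Pⱼ (X ⁻¹) (Y ⁻¹) ⟩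
      sign n * Pₖ * (sign eₖ * X ⁻¹) * (sign eⱼ * Y ⁻¹ * (F′ * Pⱼ))
        ≡⟨ cong₂ (λ s t → sign n * Pₖ * s * t) (sign-*-⁻¹ eₖ X) inverted ⟨
      sign n * Pₖ * (sign eₖ * X) ⁻¹ * (sign eⱼ * Y * (F′ * Pⱼ) ⁻¹) ⁻¹
        ≡⟨ cong₂ (λ t l → t * l ⁻¹) (residue-closed j k) (lagrangeBasis-closed j k) ⟨
      residue j k * lagrangeBasis j (Us j) ⁻¹
        ∎
      where
      kn = toℕ k
      jn = toℕ j
      rk = n ∸ kn
      rj = n ∸ jn
      σ = negOnePow ((+ (n ℕ.* (suc a ℕ.+ kn ℕ.+ jn)) ℤ.- + (kn C 2)) ℤ.- + (jn C 2))
      F = fibℚ (suc a ℕ.+ kn ℕ.+ jn)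
      F′ = fibℚ (suc a ℕ.+ jn ℕ.+ kn)
      b₁ = fibonomial (suc a ℕ.+ n ℕ.+ kn) rj
      b₂ = fibonomial (suc a ℕ.+ n ℕ.+ jn) rk
      b₃ = fibonomial (suc a ℕ.+ kn ℕ.+ jn ∸ 1) kn
      b₄ = fibonomial (suc a ℕ.+ kn ℕ.+ jn ∸ 1) jn
      eₖ = spacingExp a kn rk
      eⱼ = spacingExp 0 jn rj
      Pₖ = fibProdExcept (suc a ℕ.+ kn) j
      Pⱼ = fibProdExcept (suc a ℕ.+ jn) k
      X = fibonorial kn * fibonorial rk
      Y = fibonorial jn * fibonorial rj
      pairₖ : b₁ * b₄ ≡ Pₖ * Y ⁻¹
      pairₖ = trans (cong (λ m → fibonomial (suc m) rj * b₄) (+-right-comm a n kn)) (fibonomial-pair (a ℕ.+ kn) n j)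
      pairⱼ : b₂ * b₃ ≡ Pⱼ * X ⁻¹
      pairⱼ = trans (cong₂ (λ m m′ → fibonomial (suc m) rk * fibonomial m′ kn) (+-right-comm a n jn) (+-right-comm a kn jn))
                    (fibonomial-pair (a ℕ.+ jn) n k)
      inverted : (sign eⱼ * Y * (F′ * Pⱼ) ⁻¹) ⁻¹ ≡ sign eⱼ * Y ⁻¹ * (F′ * Pⱼ)
      inverted = trans (ratio-⁻¹ (sign eⱼ * Y) (F′ * Pⱼ)) (cong (_* (F′ * Pⱼ)) (sign-*-⁻¹ eⱼ Y))
      regroup : ∀ σ F p q r s → σ * F * p * q * r * s ≡ σ * F * (p * s) * (q * r)
      regroup = solve-∀ ℚ-ring
      rearrange : ∀ s e e′ F P P′ x y →
        s * e * e′ * F * (P * y) * (P′ * x) ≡ s * P * (e * x) * (e′ * y * (F * P′))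
      rearrange = solve-∀ ℚ-ring

    filbert-entry : ∀ i k → filbert (suc a) n i k ≡ det (Us i) (Vs k) ⁻¹
    filbert-entry i k = trans (invFib≡fibℚ⁻¹ (suc a ℕ.+ toℕ i ℕ.+ toℕ k)) (cong _⁻¹ (sym (det-Us-Vs i k)))

    filbert-·-filbertInverse : ∀ i j → (filbert (suc a) n · filbertInverse (suc a) n) i j ≡ identity i j
    filbert-·-filbertInverse i j = begin
      sumFin (λ k → filbert (suc a) n i k * filbertInverse (suc a) n k j)
        ≡⟨ sumFin≡sum (λ k → filbert (suc a) n i k * filbertInverse (suc a) n k j) ⟩
      sum (λ k → filbert (suc a) n i k * filbertInverse (suc a) n k j)
        ≡⟨ sum-cong-≗ (λ k → trans (cong₂ _*_ (filbert-entry i k) (filbertInverse-entry k j))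
                                   (rotate (det (Us i) (Vs k) ⁻¹) (residue j k) (L ⁻¹))) ⟩
      sum (λ k → L ⁻¹ * (residue j k * det (Us i) (Vs k) ⁻¹))
        ≡⟨ *-distribˡ-sum (L ⁻¹) (λ k → residue j k * det (Us i) (Vs k) ⁻¹) ⟨
      L ⁻¹ * sum (λ k → residue j k * det (Us i) (Vs k) ⁻¹)
        ≡⟨ cong (L ⁻¹ *_) (partialFractions n (removeAt Us j) Vs (Us i) (Us≢Vs i) Vs≢Vs) ⟨
      L ⁻¹ * lagrangeBasis j (Us i)
        ≡⟨ normalised-delta j (λ i → lagrangeBasis j (Us i)) (lagrangeBasis-≢0 j) lagrangeBasis-vanishes i ⟩
      identity i j
        ∎
      where
      L = lagrangeBasis j (Us j)
      rotate : ∀ d t l → d * (t * l) ≡ l * (t * d)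
      rotate = solve-∀ ℚ-ring

  identity-sym : ∀ {m} (i j : Fin m) → identity i j ≡ identity j i
  identity-sym i j with toSum (i Fin.≟ j)
  ... | inj₁ refl = refl
  ... | inj₂ i≢j  = trans (identity-≢ i≢j) (sym (identity-≢ (i≢j ∘ sym)))

  symmetric-rightInverse⇒leftInverse : ∀ {m} (A B : Matrix m) →
    (∀ i j → A i j ≡ A j i) → (∀ i j → B i j ≡ B j i) →
    (∀ i j → (A · B) i j ≡ identity i j) → ∀ i j → (B · A) i j ≡ identity i j
  symmetric-rightInverse⇒leftInverse A B A-sym B-sym AB≡I i j = begin
    sumFin (λ k → B i k * A k j) ≡⟨ sumFin≡sum (λ k → B i k * A k j) ⟩
    sum (λ k → B i k * A k j)    ≡⟨ sum-cong-≗ (λ k → trans (ℚ.*-comm (B i k) (A k j)) (cong₂ _*_ (A-sym k j) (B-sym i k))) ⟩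
    sum (λ k → A j k * B k i)    ≡⟨ sumFin≡sum (λ k → A j k * B k i) ⟨
    (A · B) j i                  ≡⟨ AB≡I j i ⟩
    identity j i                 ≡⟨ identity-sym j i ⟩
    identity i j                 ∎

  filbert-sym : ∀ α n i j → filbert α n i j ≡ filbert α n j i
  filbert-sym α n i j = cong invFib (+-right-comm α (toℕ i) (toℕ j))

  filbertInverse-sym : ∀ α n i j → filbertInverse α n i j ≡ filbertInverse α n j i
  filbertInverse-sym α n i j rewrite +-right-comm α (toℕ i) (toℕ j) = begin
    σ (toℕ i C 2) (toℕ j C 2) * F * b₁ * b₂ * b₃ * b₄ ≡⟨ cong (λ s → s * F * b₁ * b₂ * b₃ * b₄) σ-sym ⟩
    σ (toℕ j C 2) (toℕ i C 2) * F * b₁ * b₂ * b₃ * b₄ ≡⟨ swap (σ (toℕ j C 2) (toℕ i C 2)) F b₁ b₂ b₃ b₄ ⟩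
    σ (toℕ j C 2) (toℕ i C 2) * F * b₂ * b₁ * b₄ * b₃ ∎
    where
    m = α ℕ.+ toℕ j ℕ.+ toℕ i
    σ : ℕ → ℕ → ℚ
    σ x y = negOnePow ((+ (n ℕ.* m) ℤ.- + x) ℤ.- + y)
    F = fibℚ m
    b₁ = fibonomial (α ℕ.+ n ℕ.+ toℕ i) (n ∸ toℕ j)
    b₂ = fibonomial (α ℕ.+ n ℕ.+ toℕ j) (n ∸ toℕ i)
    b₃ = fibonomial (m ∸ 1) (toℕ i)
    b₄ = fibonomial (m ∸ 1) (toℕ j)
    σ-sym : σ (toℕ i C 2) (toℕ j C 2) ≡ σ (toℕ j C 2) (toℕ i C 2)
    σ-sym = trans (negOnePow[x-b-c]≡sign[x+b+c] (n ℕ.* m) (toℕ i C 2) (toℕ j C 2))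
                  (trans (cong sign (+-right-comm (n ℕ.* m) (toℕ i C 2) (toℕ j C 2)))
                         (sym (negOnePow[x-b-c]≡sign[x+b+c] (n ℕ.* m) (toℕ j C 2) (toℕ i C 2))))
    swap : ∀ s F p q r t → s * F * p * q * r * t ≡ s * F * q * p * t * r
    swap = solve-∀ ℚ-ring

open import Data.Nat using (ℕ; _≤_; _+_; _*_; _∸_)
open import Data.Nat.Combinatorics using (_C_)
open import Data.Integer using (+_) renaming (_-_ to _⊖ℤ_)
open import Data.Rational using (ℚ) renaming (_*_ to _*ℚ_)
open import Data.Fin using (Fin; toℕ)
open import Data.Product using (_×_; _,_)
open import Relation.Binary.PropositionalEquality using (_≡_)
open import Data.Nat using (zero; suc)
import Data.Nat.Properties as ℕ
open Filbert using (filbert; filbertInverse; filbert-sym; filbertInverse-sym; symmetric-rightInverse⇒leftInverse)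
open Filbert.FilbertInverse using (filbert-·-filbertInverse)

theorem3p4 : (α : ℕ) → 1 ≤ α → (n : ℕ) →
    let A : Matrix (n + 1)
        A = λ i j → invFib (α + toℕ i + toℕ j)
        B : Matrix (n + 1)
        B = λ i j →
          negOnePow ((+ (n * (α + toℕ i + toℕ j)) ⊖ℤ + (toℕ i C 2)) ⊖ℤ + (toℕ j C 2))
          *ℚ fibℚ (α + toℕ i + toℕ j)
          *ℚ fibonomial (α + n + toℕ i) (n ∸ toℕ j)
          *ℚ fibonomial (α + n + toℕ j) (n ∸ toℕ i)
          *ℚ fibonomial (α + toℕ i + toℕ j ∸ 1) (toℕ i)
          *ℚ fibonomial (α + toℕ i + toℕ j ∸ 1) (toℕ j)
    in ((i j : Fin (n + 1)) → (A · B) i j ≡ identity i j)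
       × ((i j : Fin (n + 1)) → (B · A) i j ≡ identity i j)
theorem3p4 zero    ()  n
theorem3p4 (suc a) _   n rewrite ℕ.+-comm n 1 =
    filbert-·-filbertInverse a n
  , symmetric-rightInverse⇒leftInverse (filbert (suc a) n) (filbertInverse (suc a) n)
      (filbert-sym (suc a) n) (filbertInverse-sym (suc a) n) (filbert-·-filbertInverse a n)
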